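{- The two-sided ideal $J$ of $\mathcal U$ generated by \[ u_iu_j-u_ju_i\ (|i-j|\ge2),\quad d_id_j-d_jd_i\ (|i-j|\ge2),\quad d_iu_j-u_jd_i\ (i\ne j),\quad d_1u_1-1,\quad d_{i+1}u_{i+1}-u_id_i\ (i\ge1) \] is contained in the ideal $I$ of all elements of $\mathcal U$ that act as zero on $\mathbf C[\mathbf Y]$.
   Context: A partition is a nonincreasing sequence of nonnegative integers with finite sum; $\lambda'$ is the conjugate ($\lambda'_i$ = number of boxes in column $i$). $\mathbf Y$ is the set of partitions and $\mathbf C[\mathbf Y]$ the complex vector space with basis $\mathbf Y$. $\mathcal U$ is the free associative $\mathbf C$-algebra on generators $u_i$ ($i\ge1$) and $d_i$ ($i\ge1$), acting on $\mathbf C[\mathbf Y]$ with products acting as compositions, where $u_i(\lambda)$ is the partition obtained from $\lambda$ by adding a box to column $i$ if that is a partition and $0$ otherwise, and $d_i(\lambda)$ is the partition obtained by removing a box from column $i$ if that is a partition and $0$ otherwise. $1$ is the identity element. -}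

module Defs where

open import Level using (_⊔_)
open import Data.Nat using (ℕ; zero; suc; _≤_; _<_; _≥_; _≤?_; _≥?_; _<?_)
import Data.Nat as N
open import Data.List using (List; []; _∷_; _++_; map; concatMap; filter; length; upTo; foldr)
open import Data.List.Relation.Unary.Linked using (Linked; linked?)
open import Data.List.Relation.Unary.All using (All; all?)
import Data.List.Properties as LP
open import Data.Maybe using (Maybe; just; nothing; _>>=_)
open import Data.Product using (Σ; _×_; _,_; proj₁; proj₂; ∃)
open import Data.Product.Properties using (≡-dec)
open import Relation.Nullary using (Dec; yes; no; does)
open import Relation.Nullary.Decidable using (_×-dec_)
open import Relation.Binary.PropositionalEquality using (_≡_; refl; cong)
open import Data.Sum using () renaming (_⊎_ to _⊎′_)
open import Relation.Nullary using () renaming (¬_ to ¬′_)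
open import Algebra.Bundles using (CommutativeRing)

-- Partitions
-- A partition λ₁ ≥ λ₂ ≥ … (nonincreasing, finitely many nonzero parts)
-- is represented canonically by the finite list of its nonzero parts.

Nonincreasing : List ℕ → Set
Nonincreasing = Linked _≥_

nonincreasing? : (l : List ℕ) → Dec (Nonincreasing l)
nonincreasing? = linked? (λ m n → n ≤? m)

IsPartition : List ℕ → Set
IsPartition l = Nonincreasing l × All (0 <_) l

isPartition? : (l : List ℕ) → Dec (IsPartition l)
isPartition? l = nonincreasing? l ×-dec all? (0 <?_) l

Partition : Set
Partition = Σ (List ℕ) IsPartition

-- conjugate: the k-th entry (k = 1 … λ₁) is the number of parts ≥ k.
-- (Applied to a nonincreasing list; zero entries are ignored.)
conj : List ℕ → List ℕ
conj []          = []
conj l@(a ∷ _)   = map (λ k → length (filter (suc k ≤?_) l)) (upTo a)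

incAt : ℕ → List ℕ → List ℕ
incAt zero    []       = 1 ∷ []
incAt zero    (c ∷ cs) = suc c ∷ cs
incAt (suc k) []       = 0 ∷ incAt k []
incAt (suc k) (c ∷ cs) = c ∷ incAt k cs

decAt : ℕ → List ℕ → Maybe (List ℕ)
decAt k       []           = nothing
decAt zero    (zero  ∷ cs) = nothing
decAt zero    (suc c ∷ cs) = just (c ∷ cs)
decAt (suc k) (c ∷ cs)     = decAt k cs Data.Maybe.>>= λ cs′ → just (c ∷ cs′)

-- from a list of column lengths (a sequence padded by zeros), return the
-- partition with these columns if the sequence is a partition
fromColumns : List ℕ → Maybe Partition
fromColumns cols with nonincreasing? cols
... | no _ = nothing
... | yes _ with isPartition? (conj cols)
...   | yes p = just (conj cols , p)
...   | no _  = nothing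

-- CONVENTION: index i : ℕ stands for column i+1 (columns are 1,2,3,…).
-- addBox i λ : add a box to column i+1 of λ (nothing = "0")
addBox : ℕ → Partition → Maybe Partition
addBox i (rows , _) = fromColumns (incAt i (conj rows))

removeBox : ℕ → Partition → Maybe Partition
removeBox i (rows , _) = decAt i (conj rows) Data.Maybe.>>= fromColumns

-- Generators of 𝒰.  CONVENTION: u i denotes u_{i+1}, d i denotes d_{i+1}.

data Gen : Set where
  u : ℕ → Gen
  d : ℕ → Gen

_≟G_ : (g h : Gen) → Dec (g ≡ h)
u i ≟G u j with i N.≟ j
... | yes refl = yes refl
... | no ne    = no λ { refl → ne refl }
u i ≟G d j = no λ ()
d i ≟G u j = no λ ()
d i ≟G d j with i N.≟ j
... | yes refl = yes refl
... | no ne    = no λ { refl → ne refl }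

_≟W_ : (v w : List Gen) → Dec (v ≡ w)
_≟W_ = LP.≡-dec _≟G_

_≟L_ : (v w : List ℕ) → Dec (v ≡ w)
_≟L_ = LP.≡-dec N._≟_

actGen : Gen → Partition → Maybe Partition
actGen (u i) = addBox i
actGen (d i) = removeBox i

-- a word g₁ g₂ … gₙ acts as the composition g₁ ∘ g₂ ∘ … ∘ gₙ
actWord : List Gen → Partition → Maybe Partition
actWord []      λ′ = just λ′
actWord (g ∷ w) λ′ = actWord w λ′ Data.Maybe.>>= actGen g

-- Everything over a coefficient ring R (the paper: R = ℂ).

module Over {c ℓ} (R : CommutativeRing c ℓ) where
  open CommutativeRing R using (_≈_; _+_; _*_; -_; 0#; 1#) renaming (Carrier to K)

  sumK : List K → K
  sumK = foldr _+_ 0#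

  -- 𝒰 = free associative algebra on the generators: formal finite
  -- linear combinations of words, compared coefficientwise.
  U : Set c
  U = List (K × List Gen)

  coeffU : U → List Gen → K
  coeffU x w = sumK (map proj₁ (filter (λ p → proj₂ p ≟W w) x))

  _≈U_ : U → U → Set ℓ
  x ≈U y = ∀ w → coeffU x w ≈ coeffU y w

  oneU : U
  oneU = (1# , []) ∷ []

  zeroU : U
  zeroU = []

  _+U_ : U → U → U
  _+U_ = _++_

  _*U_ : U → U → U
  x *U y = concatMap (λ { (a , v) → map (λ { (b , w) → (a * b , v ++ w) }) y }) x

  w2 : Gen → Gen → U
  w2 g h = (1# , g ∷ h ∷ []) ∷ []

  _−U_ : U → U → U
  x −U y = x ++ map (λ { (a , w) → (- a , w) }) y

  -- the generating set of J (indices shifted: i stands for i+1)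
  data JGen : U → Set c where
    uu   : ∀ i j → 2 N.+ j ≤ i ⊎′ 2 N.+ i ≤ j → JGen (w2 (u i) (u j) −U w2 (u j) (u i))
    dd   : ∀ i j → 2 N.+ j ≤ i ⊎′ 2 N.+ i ≤ j → JGen (w2 (d i) (d j) −U w2 (d j) (d i))
    du   : ∀ i j → ¬′ (i ≡ j) → JGen (w2 (d i) (u j) −U w2 (u j) (d i))
    d1u1 : JGen (w2 (d 0) (u 0) −U oneU)
    dudu : ∀ i → JGen (w2 (d (suc i)) (u (suc i)) −U w2 (u i) (d i))

  data InJ : U → Set (c ⊔ ℓ) where
    gen  : ∀ {x} → JGen x → InJ x
    zer  : InJ zeroU
    add  : ∀ {x y} → InJ x → InJ y → InJ (x +U y)
    mulˡ : ∀ a {x} → InJ x → InJ (a *U x)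
    mulʳ : ∀ {x} → InJ x → ∀ b → InJ (x *U b)
    resp : ∀ {x y} → x ≈U y → InJ x → InJ y

  V : Set c
  V = List (K × Partition)

  coeffV : V → Partition → K
  coeffV v μ = sumK (map proj₁ (filter (λ p → proj₁ (proj₂ p) ≟L proj₁ μ) v))

  IsZeroV : V → Set ℓ
  IsZeroV v = ∀ μ → coeffV v μ ≈ 0#

  actOn : List Gen → K × Partition → V
  actOn w (b , λ′) with actWord w λ′
  ... | just μ  = (b , μ) ∷ []
  ... | nothing = []

  act : U → V → V
  act x v = concatMap (λ { (a , w) → map (λ { (b , μ) → (a * b , μ) }) (concatMap (actOn w) v) }) x

  InI : U → Set (c ⊔ ℓ)
  InI x = ∀ (v : V) → IsZeroV (act x v)

-- A partition is determined by its nonincreasing sequence of column lengths, and u_i, d_i act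
-- on that sequence by adding or subtracting 1 at position i when the result is again
-- nonincreasing (and 0 otherwise).  On such sequences every defining relation of J can be checked
-- directly: the two sides are defined under the same conditions and then yield the same sequence,
-- so the two words of each generator act identically on partitions.  Words acting identically form
-- a congruence, hence any functional on words that only depends on the action of the word kills
-- the whole ideal J; the coefficient of μ in x·λ is such a functional evaluated at x.

module Submission where

open import Defs
open import Algebra.Bundles using (CommutativeRing)
import Data.Nat as Nat
open import Data.Nat using (ℕ; zero; suc; pred; >-nonZero; _≤_; _<_; _≤?_; _<?_; z≤n; s≤s)
open import Data.Nat.Properties
  using (≤-refl; ≤-trans; ≤-antisym; ≤-irrelevant; <-irrelevant; <-≤-trans; ≤-<-trans; <-trans;
         n<1+n; n≤1+n; ≤-reflexive; suc-pred; pred-cancel-<; ≮⇒≥; n≮0; <-irrefl; <⇒≢; >⇒≢;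
         pred[n]≤n; pred-mono-≤; ≤-pred)
open import Data.List using (List; []; _∷_; _++_; map; filter; length; applyUpTo; concatMap)
import Data.List.Properties as List
open import Data.List.Relation.Unary.Linked as Linked using ([]; [-]; _∷_)
open import Data.List.Relation.Unary.All as All using (All; []; _∷_)
open import Data.Maybe as Maybe using (Maybe; just; nothing; _>>=_; when)
open import Data.Maybe.Relation.Binary.Pointwise as Pointwise using (Pointwise; just; nothing)
open import Data.Product using (∃; _×_; _,_; proj₁; proj₂)
open import Data.Sum using (_⊎_; inj₁; inj₂; swap)
open import Data.Empty using (⊥-elim)
open import Data.Unit using (⊤; tt)
open import Function using (_∘_; id)
open import Relation.Nullary using (Dec; yes; no; ¬_; does)
open import Relation.Nullary.Decidable using (dec-true; dec-false; _×-dec_)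
open import Relation.Binary.PropositionalEquality
  using (_≡_; _≢_; _≗_; refl; sym; trans; cong; cong₂; subst; subst₂; ≢-sym)

infixl 9 _!_

_!_ : List ℕ → ℕ → ℕ
[]       ! _     = 0
(x ∷ _)  ! zero  = x
(_ ∷ xs) ! suc k = xs ! k

Antitone : (ℕ → ℕ) → Set
Antitone f = ∀ k → f (suc k) ≤ f k

antitone-cong : ∀ {f g} → f ≗ g → Antitone f → Antitone g
antitone-cong e a k = subst₂ _≤_ (e (suc k)) (e k) (a k)

nonincreasing⇒antitone : ∀ {l} → Nonincreasing l → Antitone (l !_)
nonincreasing⇒antitone []       _       = z≤n
nonincreasing⇒antitone [-]      _       = z≤n
nonincreasing⇒antitone (x≥y ∷ _) zero   = x≥y
nonincreasing⇒antitone (_ ∷ ni) (suc k) = nonincreasing⇒antitone ni k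

antitone⇒nonincreasing : ∀ l → Antitone (l !_) → Nonincreasing l
antitone⇒nonincreasing []          _ = []
antitone⇒nonincreasing (_ ∷ [])    _ = [-]
antitone⇒nonincreasing (_ ∷ y ∷ l) a = a 0 ∷ antitone⇒nonincreasing (y ∷ l) (a ∘ suc)

head-≥ : ∀ {a l} → Nonincreasing (a ∷ l) → ∀ j → (a ∷ l) ! j ≤ a
head-≥ _          zero    = ≤-refl
head-≥ [-]        (suc j) = z≤n
head-≥ (a≥b ∷ ni) (suc j) = ≤-trans (head-≥ ni j) a≥b

lowerSet⊆⇒≤ : ∀ {m n} → (∀ j → j < m → j < n) → m ≤ n
lowerSet⊆⇒≤ {zero}  _ = z≤n
lowerSet⊆⇒≤ {suc m} f = f m ≤-refl

-- The cell in row j and column k (both counted from 0) of the diagram with row lengths l.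
Box : List ℕ → ℕ → ℕ → Set
Box l j k = k < l ! j

box-ext : ∀ l l′ j → (∀ k → Box l j k → Box l′ j k) → (∀ k → Box l′ j k → Box l j k) →
          l ! j ≡ l′ ! j
box-ext l l′ j f g = ≤-antisym (lowerSet⊆⇒≤ f) (lowerSet⊆⇒≤ g)

count : ℕ → List ℕ → ℕ
count k l = length (filter (suc k ≤?_) l)

count-accept : ∀ {k a} l → k < a → count k (a ∷ l) ≡ suc (count k l)
count-accept {k} l k<a = cong length (List.filter-accept (suc k ≤?_) k<a)

count-reject : ∀ {k a} l → ¬ k < a → count k (a ∷ l) ≡ count k l
count-reject {k} l k≮a = cong length (List.filter-reject (suc k ≤?_) k≮a)

box⇒<count : ∀ {l} → Nonincreasing l → ∀ j k → Box l j k → j < count k l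
box⇒<count {a ∷ l} ni zero    k box rewrite count-accept l box = s≤s z≤n
box⇒<count {a ∷ l} ni (suc j) k box rewrite count-accept {k} {a} l (<-≤-trans box (head-≥ ni (suc j))) =
  s≤s (box⇒<count (Linked.tail ni) j k box)

<count⇒box : ∀ {l} → Nonincreasing l → ∀ j k → j < count k l → Box l j k
<count⇒box {a ∷ l} ni j k j<count with k <? a
<count⇒box {a ∷ l} ni zero    k _       | yes k<a = k<a
<count⇒box {a ∷ l} ni (suc j) k j<count | yes k<a rewrite count-accept l k<a =
  <count⇒box (Linked.tail ni) j k (≤-pred j<count)
<count⇒box {a ∷ l} ni j       k j<count | no k≮a rewrite count-reject l k≮a =
  ⊥-elim (k≮a (<-≤-trans (<count⇒box (Linked.tail ni) j k j<count) (head-≥ ni (suc j))))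

map-applyUpTo-!< : ∀ (F g : ℕ → ℕ) n k → k < n → map F (applyUpTo g n) ! k ≡ F (g k)
map-applyUpTo-!< F g (suc n) zero    _   = refl
map-applyUpTo-!< F g (suc n) (suc k) k<n = map-applyUpTo-!< F (g ∘ suc) n k (≤-pred k<n)

map-applyUpTo-!≥ : ∀ (F g : ℕ → ℕ) n k → n ≤ k → map F (applyUpTo g n) ! k ≡ 0
map-applyUpTo-!≥ F g zero    k       _   = refl
map-applyUpTo-!≥ F g (suc n) (suc k) n≤k = map-applyUpTo-!≥ F (g ∘ suc) n k (≤-pred n≤k)

conj-!< : ∀ a l {k} → k < a → conj (a ∷ l) ! k ≡ count k (a ∷ l)
conj-!< a l {k} = map-applyUpTo-!< (λ k → count k (a ∷ l)) id a k

conj-!≥ : ∀ a l {k} → a ≤ k → conj (a ∷ l) ! k ≡ 0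
conj-!≥ a l {k} = map-applyUpTo-!≥ (λ k → count k (a ∷ l)) id a k

box-conj⁺ : ∀ {l} → Nonincreasing l → ∀ {j k} → Box l j k → Box (conj l) k j
box-conj⁺ {a ∷ l} ni {j} {k} box with k <? a
... | yes k<a rewrite conj-!< a l k<a = box⇒<count ni j k box
... | no k≮a  = ⊥-elim (k≮a (<-≤-trans box (head-≥ ni j)))

box-conj⁻ : ∀ {l} → Nonincreasing l → ∀ {j k} → Box (conj l) k j → Box l j k
box-conj⁻ {a ∷ l} ni {j} {k} box with k <? a
... | yes k<a rewrite conj-!< a l k<a = <count⇒box ni j k box
... | no k≮a  rewrite conj-!≥ a l (≮⇒≥ k≮a) = ⊥-elim (n≮0 box)

conj-antitone : ∀ {l} → Nonincreasing l → Antitone (conj l !_)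
conj-antitone ni k = lowerSet⊆⇒≤ λ j box → box-conj⁺ ni (<-trans (n<1+n k) (box-conj⁻ ni box))

conj-nonincreasing : ∀ {l} → Nonincreasing l → Nonincreasing (conj l)
conj-nonincreasing ni = antitone⇒nonincreasing _ (conj-antitone ni)

conj-positive : ∀ l → All (0 <_) (conj l)
conj-positive []      = []
conj-positive (a ∷ l) = go id a λ k k<a → subst (0 <_) (sym (count-accept l k<a)) (s≤s z≤n)
  where
  go : ∀ g n → (∀ k → k < n → 0 < count (g k) (a ∷ l)) →
       All (0 <_) (map (λ k → count k (a ∷ l)) (applyUpTo g n))
  go g zero    _   = []
  go g (suc n) positive = positive 0 (s≤s z≤n) ∷ go (g ∘ suc) n (λ k k<n → positive (suc k) (s≤s k<n))

conj-involutive : ∀ {l} → Nonincreasing l → (conj (conj l) !_) ≗ (l !_)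
conj-involutive {l} ni j = box-ext (conj (conj l)) l j
  (λ k box → box-conj⁻ ni (box-conj⁻ (conj-nonincreasing ni) box))
  (λ k box → box-conj⁺ (conj-nonincreasing ni) (box-conj⁺ ni box))

positive-ext : ∀ {r r′} → All (0 <_) r → All (0 <_) r′ → (r !_) ≗ (r′ !_) → r ≡ r′
positive-ext []       []         _ = refl
positive-ext []       (p′ ∷ _)   e = ⊥-elim (<-irrefl (e 0) p′)
positive-ext (p ∷ _)  []         e = ⊥-elim (<-irrefl (sym (e 0)) p)
positive-ext (_ ∷ ps) (_ ∷ ps′)  e = cong₂ _∷_ (e 0) (positive-ext ps ps′ (e ∘ suc))

conj-injective : ∀ {r r′} → IsPartition r → IsPartition r′ → (conj r !_) ≗ (conj r′ !_) → r ≡ r′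
conj-injective {r} {r′} (ni , ps) (ni′ , ps′) e = positive-ext ps ps′ λ j → box-ext r r′ j
  (λ k box → box-conj⁻ ni′ (subst (j <_) (e k) (box-conj⁺ ni box)))
  (λ k box → box-conj⁻ ni (subst (j <_) (sym (e k)) (box-conj⁺ ni′ box)))

isPartition-irrelevant : ∀ {r} (p p′ : IsPartition r) → p ≡ p′
isPartition-irrelevant (ni , ps) (ni′ , ps′) =
  cong₂ _,_ (Linked.irrelevant ≤-irrelevant ni ni′) (All.irrelevant <-irrelevant ps ps′)

columns : Partition → ℕ → ℕ
columns (rows , _) = conj rows !_

columns-antitone : ∀ μ → Antitone (columns μ)
columns-antitone (_ , ni , _) = conj-antitone ni

columns-injective : ∀ {μ ν} → columns μ ≗ columns ν → μ ≡ ν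
columns-injective {r , p} {r′ , p′} e with conj-injective p p′ e
... | refl = cong (r ,_) (isPartition-irrelevant p p′)

fromColumns-antitone : ∀ L {f} → (L !_) ≗ f → Antitone f → ∃ λ μ → fromColumns L ≡ just μ × columns μ ≗ f
fromColumns-antitone L {f} e a with nonincreasing? L
... | no ¬ni = ⊥-elim (¬ni (antitone⇒nonincreasing L (antitone-cong (sym ∘ e) a)))
... | yes ni with isPartition? (conj L)
...   | yes p = (conj L , p) , refl , λ k → trans (conj-involutive ni k) (e k)
...   | no ¬p = ⊥-elim (¬p (conj-nonincreasing ni , conj-positive L))

fromColumns-¬antitone : ∀ L → ¬ Antitone (L !_) → fromColumns L ≡ nothing
fromColumns-¬antitone L ¬a with nonincreasing? L
... | no _   = refl
... | yes ni = ⊥-elim (¬a (nonincreasing⇒antitone ni))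

update : (ℕ → ℕ) → ℕ → (ℕ → ℕ) → ℕ → ℕ
update φ zero    f zero    = φ (f zero)
update φ zero    f (suc k) = f (suc k)
update φ (suc i) f zero    = f zero
update φ (suc i) f (suc k) = update φ i (f ∘ suc) k

update-same : ∀ φ i f → update φ i f i ≡ φ (f i)
update-same φ zero    f = refl
update-same φ (suc i) f = update-same φ i (f ∘ suc)

update-other : ∀ φ i f {k} → k ≢ i → update φ i f k ≡ f k
update-other φ zero    f {zero}  k≢i = ⊥-elim (k≢i refl)
update-other φ zero    f {suc k} k≢i = refl
update-other φ (suc i) f {zero}  k≢i = refl
update-other φ (suc i) f {suc k} k≢i = update-other φ i (f ∘ suc) (k≢i ∘ cong suc)

update-comm : ∀ φ ψ {i j} f → i ≢ j → update φ i (update ψ j f) ≗ update ψ j (update φ i f)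
update-comm φ ψ {zero}  {zero}  f i≢j _       = ⊥-elim (i≢j refl)
update-comm φ ψ {zero}  {suc j} f i≢j zero    = refl
update-comm φ ψ {zero}  {suc j} f i≢j (suc k) = refl
update-comm φ ψ {suc i} {zero}  f i≢j zero    = refl
update-comm φ ψ {suc i} {zero}  f i≢j (suc k) = refl
update-comm φ ψ {suc i} {suc j} f i≢j zero    = refl
update-comm φ ψ {suc i} {suc j} f i≢j (suc k) = update-comm φ ψ (f ∘ suc) (i≢j ∘ cong suc) k

update-cancel : ∀ φ ψ i f → φ (ψ (f i)) ≡ f i → update φ i (update ψ i f) ≗ f
update-cancel φ ψ zero    f e zero    = e
update-cancel φ ψ zero    f e (suc k) = refl
update-cancel φ ψ (suc i) f e zero    = refl
update-cancel φ ψ (suc i) f e (suc k) = update-cancel φ ψ i (f ∘ suc) e k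

update-cong : ∀ φ i {f g} → f ≗ g → update φ i f ≗ update φ i g
update-cong φ zero    e zero    = cong φ (e zero)
update-cong φ zero    e (suc k) = e (suc k)
update-cong φ (suc i) e zero    = e zero
update-cong φ (suc i) e (suc k) = update-cong φ i (e ∘ suc) k

incAt-! : ∀ i L → (incAt i L !_) ≗ update suc i (L !_)
incAt-! zero    []       zero    = refl
incAt-! zero    []       (suc k) = refl
incAt-! zero    (c ∷ cs) zero    = refl
incAt-! zero    (c ∷ cs) (suc k) = refl
incAt-! (suc i) []       zero    = refl
incAt-! (suc i) []       (suc k) = incAt-! i [] k
incAt-! (suc i) (c ∷ cs) zero    = refl
incAt-! (suc i) (c ∷ cs) (suc k) = incAt-! i cs k

decAt-view : ∀ i L → (L ! i ≡ 0 × decAt i L ≡ nothing)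
  ⊎ ∃ λ L′ → decAt i L ≡ just L′ × 0 < L ! i × (L′ !_) ≗ update pred i (L !_)
decAt-view zero    []           = inj₁ (refl , refl)
decAt-view (suc i) []           = inj₁ (refl , refl)
decAt-view zero    (zero  ∷ cs) = inj₁ (refl , refl)
decAt-view zero    (suc c ∷ cs) = inj₂ (c ∷ cs , refl , s≤s z≤n , λ { zero → refl ; (suc k) → refl })
decAt-view (suc i) (c ∷ cs) with decAt-view i cs
... | inj₁ (empty , eq)           rewrite eq = inj₁ (empty , refl)
... | inj₂ (L′ , eq , nonempty , spec) rewrite eq =
  inj₂ (c ∷ L′ , refl , nonempty , λ { zero → refl ; (suc k) → spec k })

column : Gen → ℕ
column (u i) = i
column (d i) = i

shift : Gen → ℕ → ℕ
shift (u _) = suc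
shift (d _) = pred

neighbour : Gen → ℕ
neighbour (u i) = pred i
neighbour (d i) = suc i

-- The changed sequence is again nonincreasing; for d i this also forces column i to be nonempty.
Admissible : Gen → (ℕ → ℕ) → Set
Admissible (u zero)    c = ⊤
Admissible (u (suc i)) c = c (suc i) < c i
Admissible (d i)       c = c (suc i) < c i

admissible? : ∀ g c → Dec (Admissible g c)
admissible? (u zero)    c = yes tt
admissible? (u (suc i)) c = c (suc i) <? c i
admissible? (d i)       c = c (suc i) <? c i

admissible-local : ∀ g {c c′} → c (column g) ≡ c′ (column g) → c (neighbour g) ≡ c′ (neighbour g) →
                   Admissible g c → Admissible g c′
admissible-local (u zero)    _ _  _   = tt
admissible-local (u (suc i)) e e′ adm = subst₂ _<_ e e′ adm
admissible-local (d i)       e e′ adm = subst₂ _<_ e′ e adm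

admissible-cong : ∀ g {c c′} → c ≗ c′ → Admissible g c → Admissible g c′
admissible-cong g e = admissible-local g (e (column g)) (e (neighbour g))

move : Gen → (ℕ → ℕ) → ℕ → ℕ
move g = update (shift g) (column g)

-- Opaque so that case splits on the admissibility test do not unfold step in goals.
opaque
  step : Gen → (ℕ → ℕ) → Maybe (ℕ → ℕ)
  step g c = when (does (admissible? g c)) (move g c)

  step-admissible : ∀ g c → Admissible g c → step g c ≡ just (move g c)
  step-admissible g c adm rewrite dec-true (admissible? g c) adm = refl

  step-inadmissible : ∀ g c → ¬ Admissible g c → step g c ≡ nothing
  step-inadmissible g c ¬adm rewrite dec-false (admissible? g c) ¬adm = refl

stepWord : List Gen → (ℕ → ℕ) → Maybe (ℕ → ℕ)
stepWord []      c = just c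
stepWord (g ∷ w) c = stepWord w c >>= step g

move-antitone : ∀ g {c} → Antitone c → Admissible g c → Antitone (move g c)
move-antitone (u i) {c} a adm k with suc k Nat.≟ i | k Nat.≟ i
... | yes refl | _ rewrite update-same suc (suc k) c | update-other suc (suc k) c (<⇒≢ (n<1+n k)) = adm
... | no sk≢i  | yes refl rewrite update-same suc k c | update-other suc k c sk≢i = ≤-trans (a k) (n≤1+n _)
... | no sk≢i  | no k≢i rewrite update-other suc i c k≢i | update-other suc i c sk≢i = a k
move-antitone (d i) {c} a adm k with suc k Nat.≟ i | k Nat.≟ i
... | yes refl | _ rewrite update-same pred (suc k) c | update-other pred (suc k) c (<⇒≢ (n<1+n k)) =
  ≤-trans pred[n]≤n (a k)
... | no sk≢i  | yes refl rewrite update-same pred k c | update-other pred k c sk≢i = pred-mono-≤ adm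
... | no sk≢i  | no k≢i rewrite update-other pred i c k≢i | update-other pred i c sk≢i = a k

inadmissible-u : ∀ i {c} → ¬ Admissible (u i) c → ¬ Antitone (move (u i) c)
inadmissible-u zero    ¬adm _ = ¬adm tt
inadmissible-u (suc i) {c} ¬adm a
  with a i
... | le rewrite update-same suc (suc i) c | update-other suc (suc i) c (<⇒≢ (n<1+n i)) = ¬adm le

inadmissible-d : ∀ i {c} → 0 < c i → ¬ Admissible (d i) c → ¬ Antitone (move (d i) c)
inadmissible-d i {c} nonempty ¬adm a
  with a i
... | le rewrite update-same pred i c | update-other pred i c (>⇒≢ (n<1+n i)) =
  ¬adm (≤-<-trans le (≤-reflexive (suc-pred (c i) {{>-nonZero nonempty}})))

infix 4 _≈ᶜ_

_≈ᶜ_ : Maybe (ℕ → ℕ) → Maybe (ℕ → ℕ) → Set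
_≈ᶜ_ = Pointwise _≗_

≈ᶜ-sym : ∀ {m m′} → m ≈ᶜ m′ → m′ ≈ᶜ m
≈ᶜ-sym = Pointwise.sym (λ e → sym ∘ e)

≈ᶜ-trans : ∀ {m m′ m″} → m ≈ᶜ m′ → m′ ≈ᶜ m″ → m ≈ᶜ m″
≈ᶜ-trans = Pointwise.trans (λ e e′ k → trans (e k) (e′ k))

≈ᶜ-just : ∀ {m m′ f f′} → m ≡ just f → m′ ≡ just f′ → f ≗ f′ → m ≈ᶜ m′
≈ᶜ-just refl refl e = just e

≈ᶜ-nothing : ∀ {m m′} → m ≡ nothing → m′ ≡ nothing → m ≈ᶜ m′
≈ᶜ-nothing refl refl = nothing

addBox-columns : ∀ i μ → Maybe.map columns (addBox i μ) ≈ᶜ step (u i) (columns μ)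
addBox-columns i μ@(r , _) with admissible? (u i) (columns μ)
... | yes adm with fromColumns-antitone (incAt i (conj r)) (incAt-! i (conj r))
                     (move-antitone (u i) (columns-antitone μ) adm)
...   | ν , eq , e = ≈ᶜ-just (cong (Maybe.map columns) eq) (step-admissible (u i) (columns μ) adm) e
addBox-columns i μ@(r , _) | no ¬adm = ≈ᶜ-nothing
  (cong (Maybe.map columns) (fromColumns-¬antitone (incAt i (conj r)) not-antitone))
  (step-inadmissible (u i) (columns μ) ¬adm)
  where
  not-antitone : ¬ Antitone (incAt i (conj r) !_)
  not-antitone = inadmissible-u i ¬adm ∘ antitone-cong (incAt-! i (conj r))

removeBox-columns : ∀ i μ → Maybe.map columns (removeBox i μ) ≈ᶜ step (d i) (columns μ)
removeBox-columns i μ@(r , _) with decAt-view i (conj r) | admissible? (d i) (columns μ)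
... | inj₁ (empty , _) | yes adm = ⊥-elim (n≮0 (subst (columns μ (suc i) <_) empty adm))
... | inj₁ (_ , eq)    | no ¬adm =
  ≈ᶜ-nothing (cong (Maybe.map columns ∘ (_>>= fromColumns)) eq) (step-inadmissible (d i) (columns μ) ¬adm)
... | inj₂ (L′ , eq , _ , spec) | yes adm
  with fromColumns-antitone L′ spec (move-antitone (d i) (columns-antitone μ) adm)
...   | ν , eq′ , e =
  ≈ᶜ-just (cong (Maybe.map columns) (trans (cong (_>>= fromColumns) eq) eq′)) (step-admissible (d i) (columns μ) adm) e
removeBox-columns i μ@(r , _) | inj₂ (L′ , eq , nonempty , spec) | no ¬adm = ≈ᶜ-nothing
  (cong (Maybe.map columns) (trans (cong (_>>= fromColumns) eq) (fromColumns-¬antitone L′ not-antitone)))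
  (step-inadmissible (d i) (columns μ) ¬adm)
  where
  not-antitone : ¬ Antitone (L′ !_)
  not-antitone = inadmissible-d i nonempty ¬adm ∘ antitone-cong spec

actGen-columns : ∀ g μ → Maybe.map columns (actGen g μ) ≈ᶜ step g (columns μ)
actGen-columns (u i) = addBox-columns i
actGen-columns (d i) = removeBox-columns i

step-cong : ∀ g {c c′} → c ≗ c′ → step g c ≈ᶜ step g c′
step-cong g {c} {c′} e with admissible? g c
... | yes adm = ≈ᶜ-just (step-admissible g c adm) (step-admissible g c′ (admissible-cong g e adm))
                        (update-cong (shift g) (column g) e)
... | no ¬adm = ≈ᶜ-nothing (step-inadmissible g c ¬adm)
                           (step-inadmissible g c′ (¬adm ∘ admissible-cong g (sym ∘ e)))

actWord-columns : ∀ w μ → Maybe.map columns (actWord w μ) ≈ᶜ stepWord w (columns μ)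
actWord-columns []      μ = just (λ _ → refl)
actWord-columns (g ∷ w) μ = bind {actWord w μ} (actWord-columns w μ)
  where
  bind : ∀ {m F} → Maybe.map columns m ≈ᶜ F → Maybe.map columns (m >>= actGen g) ≈ᶜ (F >>= step g)
  bind {just ν} (just e) = ≈ᶜ-trans (actGen-columns g ν) (step-cong g e)
  bind {nothing} nothing = nothing

map-columns-injective : ∀ {m m′} → Maybe.map columns m ≈ᶜ Maybe.map columns m′ → m ≡ m′
map-columns-injective {just _}  {just _}  (just e) = cong just (columns-injective e)
map-columns-injective {nothing} {nothing} nothing  = refl

ActEq : List Gen → List Gen → Set
ActEq w w′ = ∀ μ → actWord w μ ≡ actWord w′ μ

stepWord-≈ᶜ⇒ActEq : ∀ {w w′} → (∀ c → Antitone c → stepWord w c ≈ᶜ stepWord w′ c) → ActEq w w′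
stepWord-≈ᶜ⇒ActEq {w} {w′} e μ = map-columns-injective
  (≈ᶜ-trans (actWord-columns w μ)
    (≈ᶜ-trans (e (columns μ) (columns-antitone μ)) (≈ᶜ-sym (actWord-columns w′ μ))))

actWord-++ : ∀ xs ys μ → actWord (xs ++ ys) μ ≡ (actWord ys μ >>= actWord xs)
actWord-++ []       ys μ with actWord ys μ
... | just _  = refl
... | nothing = refl
actWord-++ (x ∷ xs) ys μ rewrite actWord-++ xs ys μ with actWord ys μ
... | just _  = refl
... | nothing = refl

ActEq-congˡ : ∀ p w w′ → ActEq w w′ → ActEq (p ++ w) (p ++ w′)
ActEq-congˡ p w w′ e μ rewrite actWord-++ p w μ | actWord-++ p w′ μ | e μ = refl

ActEq-congʳ : ∀ q w w′ → ActEq w w′ → ActEq (w ++ q) (w′ ++ q)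
ActEq-congʳ q w w′ e μ rewrite actWord-++ w q μ | actWord-++ w′ q μ with actWord q μ
... | just ν  = e ν
... | nothing = refl

Admissible₂ : Gen → Gen → (ℕ → ℕ) → Set
Admissible₂ g h c = Admissible h c × Admissible g (move h c)

stepWord₂-admissible : ∀ g h {c} → Admissible₂ g h c → stepWord (g ∷ h ∷ []) c ≡ just (move g (move h c))
stepWord₂-admissible g h {c} (adm , adm′) =
  trans (cong (_>>= step g) (step-admissible h c adm)) (step-admissible g (move h c) adm′)

stepWord₂-inadmissible : ∀ g h {c} → ¬ Admissible₂ g h c → stepWord (g ∷ h ∷ []) c ≡ nothing
stepWord₂-inadmissible g h {c} ¬adm₂ with admissible? h c
... | yes adm = trans (cong (_>>= step g) (step-admissible h c adm)) (step-inadmissible g (move h c) (¬adm₂ ∘ (adm ,_)))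
... | no ¬adm = cong (_>>= step g) (step-inadmissible h c ¬adm)

two-steps-≈ᶜ : ∀ g h g′ h′ c →
               (Admissible₂ g h c → Admissible₂ g′ h′ c) → (Admissible₂ g′ h′ c → Admissible₂ g h c) →
               (Admissible₂ g h c → move g (move h c) ≗ move g′ (move h′ c)) →
               stepWord (g ∷ h ∷ []) c ≈ᶜ stepWord (g′ ∷ h′ ∷ []) c
two-steps-≈ᶜ g h g′ h′ c ⇒ ⇐ eq with admissible? h c ×-dec admissible? g (move h c)
... | yes adm = ≈ᶜ-just (stepWord₂-admissible g h adm) (stepWord₂-admissible g′ h′ (⇒ adm)) (eq adm)
... | no ¬adm = ≈ᶜ-nothing (stepWord₂-inadmissible g h ¬adm) (stepWord₂-inadmissible g′ h′ (¬adm ∘ ⇐))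

-- No column read by the admissibility test of g is changed by h.
Apart : Gen → Gen → Set
Apart g h = column g ≢ column h × neighbour g ≢ column h

admissible-move⁻ : ∀ g h {c} → Apart g h → Admissible g (move h c) → Admissible g c
admissible-move⁻ g h {c} (p , n) =
  admissible-local g (update-other (shift h) (column h) c p) (update-other (shift h) (column h) c n)

admissible-move⁺ : ∀ g h {c} → Apart g h → Admissible g c → Admissible g (move h c)
admissible-move⁺ g h {c} (p , n) =
  admissible-local g (sym (update-other (shift h) (column h) c p)) (sym (update-other (shift h) (column h) c n))

apart-commute : ∀ g h → Apart g h → Apart h g → ∀ c → stepWord (g ∷ h ∷ []) c ≈ᶜ stepWord (h ∷ g ∷ []) c
apart-commute g h gh hg c = two-steps-≈ᶜ g h h g c
  (λ { (adm , adm′) → admissible-move⁻ g h gh adm′ , admissible-move⁺ h g hg adm })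
  (λ { (adm , adm′) → admissible-move⁻ h g hg adm′ , admissible-move⁺ g h gh adm })
  (λ _ → update-comm (shift g) (shift h) c (proj₁ gh))

far⇒≢ : ∀ {i j} → 2 Nat.+ j ≤ i ⊎ 2 Nat.+ i ≤ j → i ≢ j × pred i ≢ j × suc i ≢ j
far⇒≢ (inj₁ 2+j≤i) = >⇒≢ j<i , >⇒≢ (pred-mono-≤ 2+j≤i) , >⇒≢ (<-trans j<i (n<1+n _))
  where j<i = ≤-trans (n≤1+n _) 2+j≤i
far⇒≢ (inj₂ 2+i≤j) = <⇒≢ i<j , <⇒≢ (≤-<-trans pred[n]≤n i<j) , <⇒≢ 2+i≤j
  where i<j = ≤-trans (n≤1+n _) 2+i≤j

uu-commute : ∀ i j → 2 Nat.+ j ≤ i ⊎ 2 Nat.+ i ≤ j →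
             ∀ c → stepWord (u i ∷ u j ∷ []) c ≈ᶜ stepWord (u j ∷ u i ∷ []) c
uu-commute i j far with far⇒≢ far | far⇒≢ (swap far)
... | i≢j , pi≢j , _ | j≢i , pj≢i , _ = apart-commute (u i) (u j) (i≢j , pi≢j) (j≢i , pj≢i)

dd-commute : ∀ i j → 2 Nat.+ j ≤ i ⊎ 2 Nat.+ i ≤ j →
             ∀ c → stepWord (d i ∷ d j ∷ []) c ≈ᶜ stepWord (d j ∷ d i ∷ []) c
dd-commute i j far with far⇒≢ far | far⇒≢ (swap far)
... | i≢j , _ , si≢j | j≢i , _ , sj≢i = apart-commute (d i) (d j) (i≢j , si≢j) (j≢i , sj≢i)

du-commute : ∀ i j → i ≢ j → j ≢ suc i →
             ∀ c → stepWord (d i ∷ u j ∷ []) c ≈ᶜ stepWord (u j ∷ d i ∷ []) c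
du-commute i j i≢j j≢1+i = apart-commute (d i) (u j) (i≢j , ≢-sym j≢1+i) (≢-sym i≢j , pred≢ j i≢j j≢1+i)
  where
  pred≢ : ∀ j {i} → i ≢ j → j ≢ suc i → pred j ≢ i
  pred≢ zero    i≢0   _      = i≢0 ∘ sym
  pred≢ (suc j) _     j≢1+i  = j≢1+i ∘ cong suc

du-adjacent : ∀ i c → stepWord (d i ∷ u (suc i) ∷ []) c ≈ᶜ stepWord (u (suc i) ∷ d i ∷ []) c
du-adjacent i c = two-steps-≈ᶜ (d i) (u (suc i)) (u (suc i)) (d i) c
  (λ { (adm , adm′) → adm , subst₂ _<_ (sym down-above) (sym down-at)
                                      (pred-mono-≤ (subst₂ _<_ up-at up-below adm′)) })
  (λ { (adm , adm′) → adm , subst₂ _<_ (sym up-at) (sym up-below)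
                                      (pred-cancel-< (subst₂ _<_ down-above down-at adm′)) })
  (λ _ → update-comm pred suc c (<⇒≢ (n<1+n i)))
  where
  up-at : move (u (suc i)) c (suc i) ≡ suc (c (suc i))
  up-at = update-same suc (suc i) c
  up-below : move (u (suc i)) c i ≡ c i
  up-below = update-other suc (suc i) c (<⇒≢ (n<1+n i))
  down-at : move (d i) c i ≡ pred (c i)
  down-at = update-same pred i c
  down-above : move (d i) c (suc i) ≡ c (suc i)
  down-above = update-other pred i c (>⇒≢ (n<1+n i))

d₁u₁-cancel : ∀ c → Antitone c → stepWord (d 0 ∷ u 0 ∷ []) c ≈ᶜ just c
d₁u₁-cancel c a = ≈ᶜ-just (stepWord₂-admissible (d 0) (u 0) (tt , s≤s (a 0))) refl (update-cancel pred suc 0 c refl)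

du-shift : ∀ i c → Antitone c → stepWord (d (suc i) ∷ u (suc i) ∷ []) c ≈ᶜ stepWord (u i ∷ d i ∷ []) c
du-shift i c a = two-steps-≈ᶜ (d (suc i)) (u (suc i)) (u i) (d i) c
  (λ { (adm , _) → adm , lowered i adm })
  (λ { (adm , _) → adm , subst₂ _<_ (sym (update-other suc (suc i) c (>⇒≢ (n<1+n (suc i)))))
                                    (sym (update-same suc (suc i) c)) (s≤s (a (suc i))) })
  (λ { (adm , _) k → trans (update-cancel pred suc (suc i) c refl k)
                           (sym (update-cancel suc pred i c (suc-pred (c i) {{>-nonZero (≤-<-trans z≤n adm)}}) k)) })
  where
  lowered : ∀ i → c (suc i) < c i → Admissible (u i) (move (d i) c)
  lowered zero    _   = tt
  lowered (suc i) adm = subst₂ _<_ (sym (update-same pred (suc i) c)) (sym (update-other pred (suc i) c (<⇒≢ (n<1+n i))))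
                          (<-≤-trans (≤-reflexive (suc-pred (c (suc i)) {{>-nonZero (≤-<-trans z≤n adm)}})) (a i))

module Linear {c ℓ} (R : CommutativeRing c ℓ) where
  open CommutativeRing R
    renaming (Carrier to K; refl to ≈-refl; sym to ≈-sym; trans to ≈-trans)
    hiding (zero)
  open Over R
  open import Algebra.Properties.Ring ring using (-0#≈0#; -‿+-comm; -‿distribˡ-*)
  open import Algebra.Properties.Group +-group using (x∙y⁻¹≈ε⇒x≈y; x≈y⇒x∙y⁻¹≈ε)
  open import Algebra.Properties.CommutativeSemigroup +-commutativeSemigroup using (interchange; x∙yz≈y∙xz)
  open import Algebra.Properties.CommutativeSemigroup *-commutativeSemigroup
    using () renaming (x∙yz≈y∙xz to x*yz≈y*xz)
  open import Relation.Binary.Reasoning.Setoid setoid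

  lin : {A : Set} → (A → K) → List (K × A) → K
  lin Φ []            = 0#
  lin Φ ((a , w) ∷ x) = a * Φ w + lin Φ x

  lin-++ : ∀ {A : Set} (Φ : A → K) x y → lin Φ (x ++ y) ≈ lin Φ x + lin Φ y
  lin-++ Φ []            y = ≈-sym (+-identityˡ _)
  lin-++ Φ ((a , w) ∷ x) y = ≈-trans (+-congˡ (lin-++ Φ x y)) (≈-sym (+-assoc _ _ _))

  lin-cong : ∀ {A : Set} {Φ Ψ : A → K} x → (∀ w → Φ w ≈ Ψ w) → lin Φ x ≈ lin Ψ x
  lin-cong []            e = ≈-refl
  lin-cong ((a , w) ∷ x) e = +-cong (*-congˡ (e w)) (lin-cong x e)

  lin-zero : ∀ {A : Set} {Φ : A → K} x → (∀ w → Φ w ≈ 0#) → lin Φ x ≈ 0#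
  lin-zero []            e = ≈-refl
  lin-zero ((a , w) ∷ x) e = ≈-trans (+-cong (≈-trans (*-congˡ (e w)) (zeroʳ a)) (lin-zero x e)) (+-identityˡ 0#)

  lin-+ : ∀ {A : Set} (Φ Ψ : A → K) x → lin (λ w → Φ w + Ψ w) x ≈ lin Φ x + lin Ψ x
  lin-+ Φ Ψ []            = ≈-sym (+-identityˡ 0#)
  lin-+ Φ Ψ ((a , w) ∷ x) = ≈-trans (+-cong (distribˡ a (Φ w) (Ψ w)) (lin-+ Φ Ψ x)) (interchange _ _ _ _)

  lin-*ˡ : ∀ {A : Set} α (Φ : A → K) x → lin (λ w → α * Φ w) x ≈ α * lin Φ x
  lin-*ˡ α Φ []            = ≈-sym (zeroʳ α)
  lin-*ˡ α Φ ((a , w) ∷ x) = ≈-trans (+-cong (x*yz≈y*xz a α (Φ w)) (lin-*ˡ α Φ x)) (≈-sym (distribˡ α _ _))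

  lin-swap : ∀ {A B : Set} (G : A → B → K) x y →
             lin (λ v → lin (G v) y) x ≈ lin (λ w → lin (λ v → G v w) x) y
  lin-swap G []            y = ≈-sym (lin-zero y (λ _ → ≈-refl))
  lin-swap G ((α , v) ∷ x) y = begin
    α * lin (G v) y + lin (λ v → lin (G v) y) x
      ≈⟨ +-cong (≈-sym (lin-*ˡ α (G v) y)) (lin-swap G x y) ⟩
    lin (λ w → α * G v w) y + lin (λ w → lin (λ v → G v w) x) y
      ≈⟨ ≈-sym (lin-+ _ _ y) ⟩
    lin (λ w → α * G v w + lin (λ v → G v w) x) y
      ∎

  lin-concatMap : ∀ {A B : Set} (Φ : B → K) (Ψ : A → K) (F : K × A → List (K × B)) x →
                  (∀ a w → lin Φ (F (a , w)) ≈ a * Ψ w) → lin Φ (concatMap F x) ≈ lin Ψ x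
  lin-concatMap Φ Ψ F []            h = ≈-refl
  lin-concatMap Φ Ψ F ((a , w) ∷ x) h =
    ≈-trans (lin-++ Φ (F (a , w)) (concatMap F x)) (+-cong (h a w) (lin-concatMap Φ Ψ F x h))

  lin-map : ∀ {A B : Set} α (Φ : B → K) (Ψ : A → K) (g : K × A → K × B) y →
            (∀ b w → proj₁ (g (b , w)) * Φ (proj₂ (g (b , w))) ≈ α * (b * Ψ w)) →
            lin Φ (map g y) ≈ α * lin Ψ y
  lin-map α Φ Ψ g []            h = ≈-sym (zeroʳ α)
  lin-map α Φ Ψ g ((b , w) ∷ y) h = ≈-trans (+-cong (h b w) (lin-map α Φ Ψ g y h)) (≈-sym (distribˡ α _ _))

  lin-*U : ∀ (Φ : List Gen → K) x y → lin Φ (x *U y) ≈ lin (λ v → lin (λ w → Φ (v ++ w)) y) x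
  lin-*U Φ x y = lin-concatMap Φ _ _ x λ α v → lin-map α Φ (λ w → Φ (v ++ w)) _ y λ b w → *-assoc α b _

  -- x −U y unfolds to x ++ ([] −U y), so [] −U y serves as the negative of y.
  lin-negate : ∀ (Φ : List Gen → K) y → lin Φ ([] −U y) ≈ - lin Φ y
  lin-negate Φ []            = ≈-sym -0#≈0#
  lin-negate Φ ((a , w) ∷ y) =
    ≈-trans (+-cong (≈-sym (-‿distribˡ-* a (Φ w))) (lin-negate Φ y)) (-‿+-comm _ _)

  lin-−U : ∀ (Φ : List Gen → K) x y → lin Φ (x −U y) ≈ lin Φ x - lin Φ y
  lin-−U Φ x y = ≈-trans (lin-++ Φ x ([] −U y)) (+-congˡ (lin-negate Φ y))

  coeffU-++ : ∀ x y w → coeffU (x ++ y) w ≈ coeffU x w + coeffU y w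
  coeffU-++ []             y w = ≈-sym (+-identityˡ _)
  coeffU-++ ((a , w′) ∷ x) y w with w′ ≟W w
  ... | yes _ = ≈-trans (+-congˡ (coeffU-++ x y w)) (≈-sym (+-assoc _ _ _))
  ... | no _  = coeffU-++ x y w

  coeffU-negate : ∀ y w → coeffU ([] −U y) w ≈ - coeffU y w
  coeffU-negate []             w = ≈-sym -0#≈0#
  coeffU-negate ((a , w′) ∷ y) w with w′ ≟W w
  ... | yes _ = ≈-trans (+-congˡ (coeffU-negate y w)) (-‿+-comm _ _)
  ... | no _  = coeffU-negate y w

  coeffU-−U : ∀ x y w → coeffU (x −U y) w ≈ coeffU x w - coeffU y w
  coeffU-−U x y w = ≈-trans (coeffU-++ x ([] −U y) w) (+-congˡ (coeffU-negate y w))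

  dropWord : List Gen → U → U
  dropWord w₀ []            = []
  dropWord w₀ ((a , w) ∷ y) with w ≟W w₀
  ... | yes _ = dropWord w₀ y
  ... | no _  = (a , w) ∷ dropWord w₀ y

  lin-dropWord : ∀ (Φ : List Gen → K) w₀ y → lin Φ y ≈ coeffU y w₀ * Φ w₀ + lin Φ (dropWord w₀ y)
  lin-dropWord Φ w₀ []            = ≈-sym (≈-trans (+-identityʳ _) (zeroˡ _))
  lin-dropWord Φ w₀ ((a , w) ∷ y) with w ≟W w₀
  ... | yes refl = begin
    a * Φ w + lin Φ y                                     ≈⟨ +-congˡ (lin-dropWord Φ w y) ⟩
    a * Φ w + (coeffU y w * Φ w + lin Φ (dropWord w y))   ≈⟨ ≈-sym (+-assoc _ _ _) ⟩
    (a * Φ w + coeffU y w * Φ w) + lin Φ (dropWord w y)   ≈⟨ +-congʳ (≈-sym (distribʳ (Φ w) a _)) ⟩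
    (a + coeffU y w) * Φ w + lin Φ (dropWord w y)         ∎
  ... | no _ = ≈-trans (+-congˡ (lin-dropWord Φ w₀ y)) (x∙yz≈y∙xz _ _ _)

  coeffU-dropWord-same : ∀ w₀ y → coeffU (dropWord w₀ y) w₀ ≡ 0#
  coeffU-dropWord-same w₀ []            = refl
  coeffU-dropWord-same w₀ ((a , w) ∷ y) with w ≟W w₀
  ... | yes _ = coeffU-dropWord-same w₀ y
  ... | no w≢w₀ with w ≟W w₀
  ...   | yes w≡w₀ = ⊥-elim (w≢w₀ w≡w₀)
  ...   | no _     = coeffU-dropWord-same w₀ y

  coeffU-dropWord-other : ∀ w₀ w y → w₀ ≢ w → coeffU (dropWord w₀ y) w ≡ coeffU y w
  coeffU-dropWord-other w₀ w []             _ = refl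
  coeffU-dropWord-other w₀ w ((a , w′) ∷ y) w₀≢w with w′ ≟W w₀
  ... | yes refl with w′ ≟W w
  ...   | yes refl = ⊥-elim (w₀≢w refl)
  ...   | no _     = coeffU-dropWord-other w₀ w y w₀≢w
  coeffU-dropWord-other w₀ w ((a , w′) ∷ y) w₀≢w | no _ with w′ ≟W w
  ...   | yes refl = cong (a +_) (coeffU-dropWord-other w₀ w y w₀≢w)
  ...   | no _     = coeffU-dropWord-other w₀ w y w₀≢w

  length-dropWord : ∀ w₀ y → length (dropWord w₀ y) ≤ length y
  length-dropWord w₀ []            = z≤n
  length-dropWord w₀ ((a , w) ∷ y) with w ≟W w₀
  ... | yes _ = ≤-trans (length-dropWord w₀ y) (n≤1+n _)
  ... | no _  = s≤s (length-dropWord w₀ y)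

  length-dropWord-head : ∀ w a y → length (dropWord w ((a , w) ∷ y)) ≤ length y
  length-dropWord-head w a y with w ≟W w
  ... | yes _  = length-dropWord w y
  ... | no w≢w = ⊥-elim (w≢w refl)

  lin-coeffU-zero : ∀ (Φ : List Gen → K) y → (∀ w → coeffU y w ≈ 0#) → lin Φ y ≈ 0#
  lin-coeffU-zero Φ y = bounded (length y) y ≤-refl
    where
    bounded : ∀ n y → length y ≤ n → (∀ w → coeffU y w ≈ 0#) → lin Φ y ≈ 0#
    bounded n       []               _   _      = ≈-refl
    bounded zero    (_ ∷ _)          ()  _
    bounded (suc n) y@((a , w) ∷ y′) len coeff0 = begin
      lin Φ y                                  ≈⟨ lin-dropWord Φ w y ⟩
      coeffU y w * Φ w + lin Φ (dropWord w y)  ≈⟨ +-cong (≈-trans (*-congʳ (coeff0 w)) (zeroˡ _))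
                                                          (bounded n (dropWord w y) shorter dropped0) ⟩
      0# + 0#                                  ≈⟨ +-identityˡ 0# ⟩
      0#                                       ∎
      where
      shorter : length (dropWord w y) ≤ n
      shorter = ≤-trans (length-dropWord-head w a y′) (≤-pred len)
      dropped0 : ∀ w′ → coeffU (dropWord w y) w′ ≈ 0#
      dropped0 w′ with w ≟W w′
      ... | yes refl = reflexive (coeffU-dropWord-same w y)
      ... | no w≢w′  = ≈-trans (reflexive (coeffU-dropWord-other w w′ y w≢w′)) (coeff0 w′)

  lin-resp : ∀ (Φ : List Gen → K) {x y} → x ≈U y → lin Φ x ≈ lin Φ y
  lin-resp Φ {x} {y} x≈y = x∙y⁻¹≈ε⇒x≈y _ _ (≈-trans (≈-sym (lin-−U Φ x y))
    (lin-coeffU-zero Φ (x −U y) λ w → ≈-trans (coeffU-−U x y w) (x≈y⇒x∙y⁻¹≈ε (x≈y w))))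

  Invariant : (List Gen → K) → Set ℓ
  Invariant Φ = ∀ w w′ → ActEq w w′ → Φ w ≈ Φ w′

  invariant-prefix : ∀ {Φ : List Gen → K} → Invariant Φ → ∀ v → Invariant (λ w → Φ (v ++ w))
  invariant-prefix inv v w w′ e = inv (v ++ w) (v ++ w′) (ActEq-congˡ v w w′ e)

  invariant-suffix : ∀ {Φ : List Gen → K} → Invariant Φ → ∀ w → Invariant (λ v → Φ (v ++ w))
  invariant-suffix inv w v v′ e = inv (v ++ w) (v′ ++ w) (ActEq-congʳ w v v′ e)

  lin-binomial : ∀ {Φ : List Gen → K} → Invariant Φ →
                 ∀ w w′ → (∀ c → Antitone c → stepWord w c ≈ᶜ stepWord w′ c) →
                 lin Φ (((1# , w) ∷ []) −U ((1# , w′) ∷ [])) ≈ 0#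
  lin-binomial {Φ} inv w w′ same = ≈-trans (lin-−U Φ ((1# , w) ∷ []) ((1# , w′) ∷ []))
    (x≈y⇒x∙y⁻¹≈ε (+-congʳ (*-congˡ (inv w w′ (stepWord-≈ᶜ⇒ActEq {w} {w′} same)))))

  lin-JGen : ∀ {x} {Φ : List Gen → K} → JGen x → Invariant Φ → lin Φ x ≈ 0#
  lin-JGen (uu i j far) inv = lin-binomial inv (u i ∷ u j ∷ []) (u j ∷ u i ∷ []) λ c _ → uu-commute i j far c
  lin-JGen (dd i j far) inv = lin-binomial inv (d i ∷ d j ∷ []) (d j ∷ d i ∷ []) λ c _ → dd-commute i j far c
  lin-JGen (du i j i≢j) inv with j Nat.≟ suc i
  ... | yes refl = lin-binomial inv (d i ∷ u j ∷ []) (u j ∷ d i ∷ []) λ c _ → du-adjacent i c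
  ... | no j≢1+i = lin-binomial inv (d i ∷ u j ∷ []) (u j ∷ d i ∷ []) λ c _ → du-commute i j i≢j j≢1+i c
  lin-JGen d1u1         inv = lin-binomial inv (d 0 ∷ u 0 ∷ []) [] d₁u₁-cancel
  lin-JGen (dudu i)     inv = lin-binomial inv (d (suc i) ∷ u (suc i) ∷ []) (u i ∷ d i ∷ []) (du-shift i)

  InJ⇒lin-zero : ∀ {x} → InJ x → ∀ {Φ} → Invariant Φ → lin Φ x ≈ 0#
  InJ⇒lin-zero (gen g)                inv = lin-JGen g inv
  InJ⇒lin-zero zer                    inv = ≈-refl
  InJ⇒lin-zero (add {x} {y} jx jy) {Φ} inv =
    ≈-trans (lin-++ Φ x y) (≈-trans (+-cong (InJ⇒lin-zero jx inv) (InJ⇒lin-zero jy inv)) (+-identityˡ 0#))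
  InJ⇒lin-zero (mulˡ a {x} jx)     {Φ} inv =
    ≈-trans (lin-*U Φ a x) (lin-zero a λ v → InJ⇒lin-zero jx (invariant-prefix inv v))
  InJ⇒lin-zero (mulʳ {x} jx b)     {Φ} inv =
    ≈-trans (lin-*U Φ x b) (≈-trans (lin-swap _ x b) (lin-zero b λ w → InJ⇒lin-zero jx (invariant-suffix inv w)))
  InJ⇒lin-zero (resp {x} {y} x≈y jx) {Φ} inv = ≈-trans (≈-sym (lin-resp Φ {x} {y} x≈y)) (InJ⇒lin-zero jx inv)

  hits : Maybe Partition → Partition → K
  hits nothing  μ = 0#
  hits (just ν) μ with proj₁ ν ≟L proj₁ μ
  ... | yes _ = 1#
  ... | no _  = 0#

  coeffV-as-lin : ∀ z μ → coeffV z μ ≈ lin (λ ν → hits (just ν) μ) z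
  coeffV-as-lin []            μ = ≈-refl
  coeffV-as-lin ((b , ν) ∷ z) μ with proj₁ ν ≟L proj₁ μ
  ... | yes _ = +-cong (≈-sym (*-identityʳ b)) (coeffV-as-lin z μ)
  ... | no _  = ≈-trans (coeffV-as-lin z μ) (≈-sym (≈-trans (+-congʳ (zeroʳ b)) (+-identityˡ _)))

  lin-actOn : ∀ μ w b λ′ → lin (λ ν → hits (just ν) μ) (actOn w (b , λ′)) ≈ b * hits (actWord w λ′) μ
  lin-actOn μ w b λ′ with actWord w λ′
  ... | just ν  = +-identityʳ _
  ... | nothing = ≈-sym (zeroʳ b)

  invariant-hits : ∀ λ′ μ → Invariant (λ w → hits (actWord w λ′) μ)
  invariant-hits λ′ μ _ _ e = reflexive (cong (λ m → hits m μ) (e λ′))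

  lin-act : ∀ (Ψ : Partition → K) x v → lin Ψ (act x v) ≈ lin (λ w → lin Ψ (concatMap (actOn w) v)) x
  lin-act Ψ x v = lin-concatMap Ψ _ _ x λ a w → lin-map a Ψ Ψ _ (concatMap (actOn w) v) λ b ν → *-assoc a b _

  InJ⇒InI : ∀ {x} → InJ x → InI x
  InJ⇒InI {x} jx v μ = begin
    coeffV (act x v) μ                   ≈⟨ coeffV-as-lin (act x v) μ ⟩
    lin ind (act x v)                    ≈⟨ lin-act ind x v ⟩
    lin (λ w → lin ind (concatMap (actOn w) v)) x
      ≈⟨ lin-cong x (λ w → lin-concatMap ind (δ w) (actOn w) v (lin-actOn μ w)) ⟩
    lin (λ w → lin (δ w) v) x            ≈⟨ lin-swap δ x v ⟩
    lin (λ λ′ → lin (λ w → δ w λ′) x) v  ≈⟨ lin-zero v (λ λ′ → InJ⇒lin-zero jx (invariant-hits λ′ μ)) ⟩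
    0#                                   ∎
    where
    ind : Partition → K
    ind ν = hits (just ν) μ
    δ : List Gen → Partition → K
    δ w λ′ = hits (actWord w λ′) μ

proposition3p1 : ∀ {c ℓ} (R : CommutativeRing c ℓ) (x : Over.U R) → Over.InJ R x → Over.InI R x
proposition3p1 R x = Linear.InJ⇒InI R
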